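{- Let $\mathcal T$ and $\mathcal T''$ be topologies on a finite set $X$ such that $\mathcal T''$ is $\mathcal T$-admissible. Then $\mathcal T'\mapsto\mathcal T'/\mathcal T''$ is a bijection from the set of topologies $\mathcal T'$ on $X$ such that $\mathcal T''$ is $\mathcal T'$-admissible and $\mathcal T'$ is $\mathcal T$-admissible, onto the set of topologies $\mathcal U$ on $X$ which are $\mathcal T/\mathcal T''$-admissible.
   Context: For a topology $\mathcal T$ on a finite set $X$, the associated quasi-order is $x\le_{\mathcal T}y$ iff every open set containing $x$ contains $y$; topologies correspond bijectively to quasi-orders, open sets being final segments. Write $x\sim_{\mathcal T}y$ iff $x\le_{\mathcal T}y$ and $y\le_{\mathcal T}x$. Write $\mathcal T'\prec\mathcal T$ when every $\mathcal T$-open set is $\mathcal T'$-open. For $\mathcal T'\prec\mathcal T$, the quotient $\mathcal T/\mathcal T'$ is the topology on $X$ whose quasi-order is the transitive closure of $x\,\mathcal R\,y\iff(x\le_{\mathcal T}y\text{ or }y\le_{\mathcal T'}x)$. For $Y\subset X$, $\mathcal T|_Y=\{Z\cap Y:Z\in\mathcal T\}$, and $Y$ is $\mathcal T$-connected if $(Y,\mathcal T|_Y)$ is connected. $\mathcal T'$ is $\mathcal T$-admissible if $\mathcal T'\prec\mathcal T$, $\mathcal T'|_Y=\mathcal T|_Y$ for every $\mathcal T'$-connected $Y\subset X$, and $x\sim_{\mathcal T/\mathcal T'}y\iff x\sim_{\mathcal T'/\mathcal T'}y$ for all $x,y\in X$. -}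

module Defs where

open import Level using (0ℓ)
open import Data.Nat using (ℕ)
open import Data.Fin using (Fin)
open import Data.Fin.Subset using (Subset; _∈_; _∩_; _∪_; ⊥)
open import Data.Product using (Σ; _×_; _,_; ∃)
open import Data.Sum using (_⊎_; inj₁; inj₂)
open import Relation.Binary.Core using (Rel)
open import Relation.Binary.Definitions using (Decidable)
open import Relation.Binary.PropositionalEquality using (_≡_)
open import Relation.Binary.Construct.Closure.Transitive using (TransClosure; [_]; _++_)
open import Function.Bundles using (_⇔_)

-- A topology on the finite set X = Fin n, represented (via the bijective
-- correspondence recalled in the paper) by its quasi-order ≤_T.
record QuasiOrder (n : ℕ) : Set₁ where
  field
    _≤_   : Rel (Fin n) 0ℓ
    refl  : ∀ x → x ≤ x
    trans : ∀ {x y z} → x ≤ y → y ≤ z → x ≤ z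
open QuasiOrder public

-- A topology: a quasi-order whose relation is decidable (automatic
-- classically on a finite set; imposed here so that we stay constructive).
record Topology (n : ℕ) : Set₁ where
  field
    qo  : QuasiOrder n
    dec : Decidable (QuasiOrder._≤_ qo)
open Topology public

module _ {n : ℕ} where

  _∼⟨_⟩_ : Fin n → QuasiOrder n → Fin n → Set
  x ∼⟨ T ⟩ y = (_≤_ T x y) × (_≤_ T y x)

  IsOpen : QuasiOrder n → Subset n → Set
  IsOpen T U = ∀ x y → x ∈ U → _≤_ T x y → y ∈ U

  _≺_ : QuasiOrder n → QuasiOrder n → Set
  T' ≺ T = ∀ U → IsOpen T U → IsOpen T' U

  QRel : QuasiOrder n → QuasiOrder n → Rel (Fin n) 0ℓ
  QRel T T' x y = (_≤_ T x y) ⊎ (_≤_ T' y x)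

  _/_ : QuasiOrder n → QuasiOrder n → QuasiOrder n
  T / T' = record
    { _≤_   = TransClosure (QRel T T')
    ; refl  = λ x → [ inj₁ (refl T x) ]
    ; trans = _++_
    }

  RestrOpen : QuasiOrder n → Subset n → Subset n → Set
  RestrOpen T Y V = Σ (Subset n) (λ Z → IsOpen T Z × (V ≡ Z ∩ Y))

  SameRestr : QuasiOrder n → QuasiOrder n → Subset n → Set
  SameRestr T' T Y = ∀ V → RestrOpen T' Y V ⇔ RestrOpen T Y V

  Connected : QuasiOrder n → Subset n → Set
  Connected T Y = ∀ V W → RestrOpen T Y V → RestrOpen T Y W →
    V ∪ W ≡ Y → V ∩ W ≡ ⊥ → (V ≡ ⊥) ⊎ (W ≡ ⊥)

  Admissible : QuasiOrder n → QuasiOrder n → Set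
  Admissible T' T =
    (T' ≺ T)
    × (∀ Y → Connected T' Y → SameRestr T' T Y)
    × (∀ x y → (x ∼⟨ T / T' ⟩ y) ⇔ (x ∼⟨ T' / T' ⟩ y))

  _≈_ : QuasiOrder n → QuasiOrder n → Set
  T ≈ T' = ∀ x y → _≤_ T x y ⇔ _≤_ T' x y

-- A topology A is B-admissible iff
-- (i) ≤_A ⊆ ≤_B, (ii) ≤_B agrees with ≤_A between points of one connected
-- component of A, and (iii) each ∼_{B/A}-class lies in one component of A:
-- components are connected clopen sets, and a connected set lies inside one
-- component, so the restriction and class conditions reduce to (ii) and (iii).
-- In these terms every claim is a chase along zigzag chains. A chain returning
-- to its start stays in one equivalence class, where (ii) and (iii) turn each
-- T-step into a finer step. The inverse of T' ↦ T'/T'' is U ↦ T ⊓ U, the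
-- topology generated by T and U, whose quasi-order is ≤_T ∩ ≤_U.
module Submission where

open import Defs
open import Level using (Level)
open import Data.Nat using (ℕ)
open import Data.Fin using (Fin)
open import Data.Fin.Properties using (any?)
open import Data.Fin.Subset using (Subset; _∈_; _∉_; _⊆_; _∩_; _∪_; ⊥; ⊤; ∁)
open import Data.Fin.Subset.Properties
  using (⊆-antisym; ⊥⊆; ∉⊥; x∈p∩q⁺; x∈p∩q⁻; x∈p∪q⁻; _∈?_; ∩-comm; ∪-comm; ∩-identityˡ; ∩-distribʳ-∪;
         p∪∁p≡⊤; x∈∁p⇒x∉p; x∉∁p⇒x∈p; x∉p⇒x∈∁p)
open import Data.List.Base using (List; []; _∷_; allFin)
open import Data.List.Membership.Propositional using () renaming (_∈_ to _∈ₗ_)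
open import Data.List.Membership.Propositional.Properties using (∈-allFin)
open import Data.List.Relation.Unary.Any using (here; there)
open import Data.Product using (Σ; ∃; _×_; _,_; proj₁; proj₂)
open import Data.Sum using (_⊎_; inj₁; inj₂; [_,_]′; swap) renaming (map to ⊎-map)
open import Data.Vec.Base using (tabulate)
open import Data.Vec.Properties using (lookup∘tabulate; lookup⇒[]=; []=⇒lookup)
open import Function.Base using (id; _∘_)
open import Function.Bundles using (_⇔_; mk⇔; Equivalence)
open import Relation.Nullary using (Dec; yes; no; does; contradiction)
open import Relation.Nullary.Decidable using (_×-dec_; _⊎-dec_; map′; dec-true)
open import Relation.Binary.Core using (Rel; _⇒_)
open import Relation.Binary.Definitions using (Decidable; Transitive)
open import Relation.Binary.PropositionalEquality as ≡ using (_≡_)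
open import Relation.Binary.Construct.Closure.Transitive
  using (TransClosure; [_]; _∷_; _++_; _∷ʳ_; transitive⁻; symmetric)

private
  variable
    a ℓ ℓ′ : Level
    A : Set a

⁺-map : {R : Rel A ℓ} {R′ : Rel A ℓ′} → R ⇒ R′ → TransClosure R ⇒ TransClosure R′
⁺-map f [ r ]     = [ f r ]
⁺-map f (r ∷ rs) = f r ∷ ⁺-map f rs

⁺-fold : {R : Rel A ℓ} {_≤′_ : Rel A ℓ′} → Transitive _≤′_ → R ⇒ _≤′_ → TransClosure R ⇒ _≤′_
⁺-fold trans f = transitive⁻ _ trans ∘ ⁺-map f

module _ {n : ℕ} where

  subset : {P : Fin n → Set ℓ} → (∀ x → Dec (P x)) → Subset n
  subset P? = tabulate (does ∘ P?)

  ∈-subset⁺ : {P : Fin n → Set ℓ} (P? : ∀ x → Dec (P x)) {x : Fin n} → P x → x ∈ subset P?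
  ∈-subset⁺ P? {x} p = lookup⇒[]= x _ (≡.trans (lookup∘tabulate (does ∘ P?) x) (dec-true (P? x) p))

  ∈-subset⁻ : {P : Fin n → Set ℓ} (P? : ∀ x → Dec (P x)) {x : Fin n} → x ∈ subset P? → P x
  ∈-subset⁻ P? {x} x∈ with P? x | ≡.trans (≡.sym (lookup∘tabulate (does ∘ P?) x)) ([]=⇒lookup x∈)
  ... | yes p | _ = p
  ... | no _  | ()

  ≡⊥⇒∉ : ∀ {p : Subset n} {x} → p ≡ ⊥ → x ∉ p
  ≡⊥⇒∉ ≡.refl = ∉⊥

  ∩-∁-partition : ∀ (C Y : Subset n) → (C ∩ Y) ∪ (∁ C ∩ Y) ≡ Y
  ∩-∁-partition C Y = begin
    (C ∩ Y) ∪ (∁ C ∩ Y) ≡⟨ ∩-distribʳ-∪ Y C (∁ C) ⟨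
    (C ∪ ∁ C) ∩ Y       ≡⟨ ≡.cong (_∩ Y) (p∪∁p≡⊤ C) ⟩
    ⊤ ∩ Y               ≡⟨ ∩-identityˡ Y ⟩
    Y                   ∎
    where open ≡.≡-Reasoning

  ∩-∁-disjoint : ∀ (C Y : Subset n) → (C ∩ Y) ∩ (∁ C ∩ Y) ≡ ⊥
  ∩-∁-disjoint C Y = ⊆-antisym impossible ⊥⊆
    where
    impossible : (C ∩ Y) ∩ (∁ C ∩ Y) ⊆ ⊥
    impossible x∈ =
      let x∈C∩Y , x∈∁C∩Y = x∈p∩q⁻ (C ∩ Y) _ x∈
      in  contradiction (proj₁ (x∈p∩q⁻ C Y x∈C∩Y)) (x∈∁p⇒x∉p (proj₁ (x∈p∩q⁻ (∁ C) Y x∈∁C∩Y)))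

  ∈-restr⁻ : ∀ {V Z Y : Subset n} {x} → V ≡ Z ∩ Y → x ∈ V → x ∈ Z × x ∈ Y
  ∈-restr⁻ {Z = Z} {Y} ≡.refl = x∈p∩q⁻ Z Y

  ∈-restr⁺ : ∀ {V Z Y : Subset n} {x} → V ≡ Z ∩ Y → x ∈ Z → x ∈ Y → x ∈ V
  ∈-restr⁺ ≡.refl x∈Z x∈Y = x∈p∩q⁺ (x∈Z , x∈Y)

  -- Warshall's algorithm: Via R vs relates x to y when an R-chain from x to y
  -- exists all of whose intermediate points lie in vs.
  module _ {R : Rel (Fin n) ℓ} where

    Via : List (Fin n) → Rel (Fin n) ℓ
    Via []       x y = R x y
    Via (v ∷ vs) x y = Via vs x y ⊎ (Via vs x v × Via vs v y)

    Via? : Decidable R → ∀ vs → Decidable (Via vs)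
    Via? R? []       x y = R? x y
    Via? R? (v ∷ vs) x y = Via? R? vs x y ⊎-dec (Via? R? vs x v ×-dec Via? R? vs v y)

    Via⇒⁺ : ∀ vs → Via vs ⇒ TransClosure R
    Via⇒⁺ []       r                = [ r ]
    Via⇒⁺ (v ∷ vs) (inj₁ r)         = Via⇒⁺ vs r
    Via⇒⁺ (v ∷ vs) (inj₂ (r₁ , r₂)) = Via⇒⁺ vs r₁ ++ Via⇒⁺ vs r₂

    R⇒Via : ∀ vs → R ⇒ Via vs
    R⇒Via []       r = r
    R⇒Via (v ∷ vs) r = inj₁ (R⇒Via vs r)

    Via-trans : ∀ vs {x y z} → y ∈ₗ vs → Via vs x y → Via vs y z → Via vs x z
    Via-trans (v ∷ vs) (here ≡.refl) r₁ r₂ = inj₂ (into r₁ , outof r₂)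
      where
      into : ∀ {x} → Via (v ∷ vs) x v → Via vs x v
      into (inj₁ r)       = r
      into (inj₂ (r , _)) = r
      outof : ∀ {z} → Via (v ∷ vs) v z → Via vs v z
      outof (inj₁ r)       = r
      outof (inj₂ (_ , r)) = r
    Via-trans (v ∷ vs) (there y∈) (inj₁ r₁)        (inj₁ r₂)        = inj₁ (Via-trans vs y∈ r₁ r₂)
    Via-trans (v ∷ vs) (there y∈) (inj₁ r₁)        (inj₂ (r₂ , r₃)) = inj₂ (Via-trans vs y∈ r₁ r₂ , r₃)
    Via-trans (v ∷ vs) (there y∈) (inj₂ (r₁ , r₂)) (inj₁ r₃)        = inj₂ (r₁ , Via-trans vs y∈ r₂ r₃)
    Via-trans (v ∷ vs) (there y∈) (inj₂ (r₁ , _))  (inj₂ (_ , r₄))  = inj₂ (r₁ , r₄)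

    ⁺⇒Via : TransClosure R ⇒ Via (allFin n)
    ⁺⇒Via [ r ]    = R⇒Via (allFin n) r
    ⁺⇒Via (r ∷ rs) = Via-trans (allFin n) (∈-allFin _) (R⇒Via (allFin n) r) (⁺⇒Via rs)

    ⁺-dec : Decidable R → Decidable (TransClosure R)
    ⁺-dec R? x y = map′ (Via⇒⁺ (allFin n)) ⁺⇒Via (Via? R? (allFin n) x y)

  infix 4 _⊑_
  _⊑_ : QuasiOrder n → QuasiOrder n → Set
  A ⊑ B = ∀ {x y} → _≤_ A x y → _≤_ B x y

  infixl 7 _⊓_
  _⊓_ : QuasiOrder n → QuasiOrder n → QuasiOrder n
  A ⊓ B = record
    { _≤_   = λ x y → _≤_ A x y × _≤_ B x y
    ; refl  = λ x → refl A x , refl B x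
    ; trans = λ (a₁ , b₁) (a₂ , b₂) → trans A a₁ a₂ , trans B b₁ b₂
    }

  -- _≤_ (A / B) unfolds to TransClosure (Zigzag (_≤_ A) (_≤_ B)); stating the
  -- lemmas for arbitrary relations lets Agda infer their arguments.
  Zigzag : Rel (Fin n) ℓ → Rel (Fin n) ℓ′ → Rel (Fin n) _
  Zigzag R S x y = R x y ⊎ S y x

  /-dec : {R : Rel (Fin n) ℓ} {S : Rel (Fin n) ℓ′} → Decidable R → Decidable S →
    Decidable (TransClosure (Zigzag R S))
  /-dec R? S? = ⁺-dec (λ x y → R? x y ⊎-dec S? y x)

  /-mono : {R R′ : Rel (Fin n) ℓ} {S S′ : Rel (Fin n) ℓ′} →
    R ⇒ R′ → S ⇒ S′ → TransClosure (Zigzag R S) ⇒ TransClosure (Zigzag R′ S′)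
  /-mono f g = ⁺-map (⊎-map f g)

  /-least : {R : Rel (Fin n) ℓ} {S : Rel (Fin n) ℓ′} {_≤′_ : Rel (Fin n) ℓ} → Transitive _≤′_ →
    R ⇒ _≤′_ → (∀ {x y} → S x y → y ≤′ x) → TransClosure (Zigzag R S) ⇒ _≤′_
  /-least trans f g = ⁺-fold trans [ f , g ]′

  -- Along a chain that closes into a cycle in Q, consecutive points are
  -- Q-equivalent.
  ⁺-refine-cycle : ∀ (Q : QuasiOrder n) {R : Rel (Fin n) ℓ} {R′ : Rel (Fin n) ℓ′} → R ⇒ _≤_ Q →
    (∀ {a b} → R a b → a ∼⟨ Q ⟩ b → R′ a b) →
    ∀ {x y} → TransClosure R x y → _≤_ Q y x → TransClosure R′ x y
  ⁺-refine-cycle Q R⊆Q f [ r ]    y≤x = [ f r (R⊆Q r , y≤x) ]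
  ⁺-refine-cycle Q R⊆Q f (r ∷ rs) y≤x =
    f r (R⊆Q r , trans Q (⁺-fold (trans Q) R⊆Q rs) y≤x) ∷ ⁺-refine-cycle Q R⊆Q f rs (trans Q y≤x (R⊆Q r))

  -- x ≤_{A/A} y says that x and y lie in the same connected component of A.
  SameComponent : QuasiOrder n → Rel (Fin n) _
  SameComponent A = _≤_ (A / A)

  SameComponent-sym : ∀ A {x y} → SameComponent A x y → SameComponent A y x
  SameComponent-sym A = symmetric _ swap

  restrOpen-⊆ : ∀ {A : QuasiOrder n} {Y V} → RestrOpen A Y V → V ⊆ Y
  restrOpen-⊆ (_ , _ , V≡) = proj₂ ∘ ∈-restr⁻ V≡

  connected-⊆-clopen : ∀ {A : QuasiOrder n} {Y C} → Connected A Y → IsOpen A C → IsOpen A (∁ C) →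
    ∀ {z} → z ∈ Y → z ∈ C → Y ⊆ C
  connected-⊆-clopen {Y = Y} {C} Y-conn C-open ∁C-open z∈Y z∈C {w} w∈Y
    with Y-conn (C ∩ Y) (∁ C ∩ Y) (C , C-open , ≡.refl) (∁ C , ∁C-open , ≡.refl)
                (∩-∁-partition C Y) (∩-∁-disjoint C Y)
  ... | inj₁ C∩Y≡⊥  = contradiction (x∈p∩q⁺ (z∈C , z∈Y)) (≡⊥⇒∉ C∩Y≡⊥)
  ... | inj₂ ∁C∩Y≡⊥ = x∉∁p⇒x∈p (λ w∈∁C → ≡⊥⇒∉ ∁C∩Y≡⊥ (x∈p∩q⁺ (w∈∁C , w∈Y)))

  split-step : ∀ {A : QuasiOrder n} {Y V W} → RestrOpen A Y V → RestrOpen A Y W → V ∪ W ≡ Y → V ∩ W ≡ ⊥ →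
    ∀ {u v} → u ∈ V → v ∈ Y → QRel A A u v → v ∈ V
  split-step (Z , Z-open , V≡) _ _ _ u∈V v∈Y (inj₁ u≤v) =
    ∈-restr⁺ V≡ (Z-open _ _ (proj₁ (∈-restr⁻ V≡ u∈V)) u≤v) v∈Y
  split-step {A} {V = V} {W} V-open (Z′ , Z′-open , W≡) V∪W≡Y V∩W≡⊥ {u} {v} u∈V v∈Y (inj₂ v≤u)
    with x∈p∪q⁻ V W (≡.subst (v ∈_) (≡.sym V∪W≡Y) v∈Y)
  ... | inj₁ v∈V = v∈V
  ... | inj₂ v∈W = contradiction (x∈p∩q⁺ (u∈V , u∈W)) (≡⊥⇒∉ V∩W≡⊥)
    where
    u∈W : u ∈ W
    u∈W = ∈-restr⁺ W≡ (Z′-open _ _ (proj₁ (∈-restr⁻ W≡ v∈W)) v≤u) (restrOpen-⊆ {A = A} V-open u∈V)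

  module _ (A : Topology n) where

    ↑ : Fin n → Subset n
    ↑ x = subset (dec A x)

    ↑-open : ∀ x → IsOpen (qo A) (↑ x)
    ↑-open x u v u∈ u≤v = ∈-subset⁺ (dec A x) (trans (qo A) (∈-subset⁻ (dec A x) u∈) u≤v)

    Above : Subset n → Fin n → Set
    Above X w = ∃ λ z → z ∈ X × _≤_ (qo A) z w

    Above? : ∀ X w → Dec (Above X w)
    Above? X w = any? (λ z → (z ∈? X) ×-dec dec A z w)

    upClosure : Subset n → Subset n
    upClosure X = subset (Above? X)

    upClosure-open : ∀ X → IsOpen (qo A) (upClosure X)
    upClosure-open X u v u∈ u≤v =
      let z , z∈X , z≤u = ∈-subset⁻ (Above? X) u∈
      in  ∈-subset⁺ (Above? X) (z , z∈X , trans (qo A) z≤u u≤v)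

    SameComponent? : Decidable (SameComponent (qo A))
    SameComponent? = /-dec (dec A) (dec A)

    component : Fin n → Subset n
    component x = subset (SameComponent? x)

    x∈component : ∀ x → x ∈ component x
    x∈component x = ∈-subset⁺ (SameComponent? x) (refl (qo A / qo A) x)

    component-open : ∀ x → IsOpen (qo A) (component x)
    component-open x u v u∈ u≤v = ∈-subset⁺ (SameComponent? x) (∈-subset⁻ (SameComponent? x) u∈ ∷ʳ inj₁ u≤v)

    ∁component-open : ∀ x → IsOpen (qo A) (∁ (component x))
    ∁component-open x u v u∈ u≤v = x∉p⇒x∈∁p λ v∈ →
      x∈∁p⇒x∉p u∈ (∈-subset⁺ (SameComponent? x) (∈-subset⁻ (SameComponent? x) v∈ ∷ʳ inj₂ u≤v))

    connected⇒SameComponent : ∀ {Y} → Connected (qo A) Y → ∀ {z w} → z ∈ Y → w ∈ Y → SameComponent (qo A) z w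
    connected⇒SameComponent Y-conn {z} z∈Y w∈Y = ∈-subset⁻ (SameComponent? z)
      (connected-⊆-clopen {A = qo A} Y-conn (component-open z) (∁component-open z) z∈Y (x∈component z) w∈Y)

    component-split-empty : ∀ x {V W} → RestrOpen (qo A) (component x) V → RestrOpen (qo A) (component x) W →
      V ∪ W ≡ component x → V ∩ W ≡ ⊥ → x ∈ V → W ≡ ⊥
    component-split-empty x {V} {W} V-open W-open V∪W≡C V∩W≡⊥ x∈V = ⊆-antisym W⊆⊥ ⊥⊆
      where
      spread : ∀ {u z} → u ∈ V → SameComponent (qo A) x u → TransClosure (QRel (qo A) (qo A)) u z → z ∈ V
      spread u∈V x~u [ q ]    =
        split-step {A = qo A} V-open W-open V∪W≡C V∩W≡⊥ u∈V (∈-subset⁺ (SameComponent? x) (x~u ∷ʳ q)) q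
      spread u∈V x~u (q ∷ qs) = spread (spread u∈V x~u [ q ]) (x~u ∷ʳ q) qs

      W⊆⊥ : W ⊆ ⊥
      W⊆⊥ z∈W = contradiction (x∈p∩q⁺ (spread x∈V (refl (qo A / qo A) x) x~z , z∈W)) (≡⊥⇒∉ V∩W≡⊥)
        where
        x~z = ∈-subset⁻ (SameComponent? x) (restrOpen-⊆ {A = qo A} W-open z∈W)

    component-connected : ∀ x → Connected (qo A) (component x)
    component-connected x V W V-open W-open V∪W≡C V∩W≡⊥
      with x∈p∪q⁻ V W (≡.subst (x ∈_) (≡.sym V∪W≡C) (x∈component x))
    ... | inj₁ x∈V = inj₂ (component-split-empty x V-open W-open V∪W≡C V∩W≡⊥ x∈V)
    ... | inj₂ x∈W = inj₁ (component-split-empty x W-open V-open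
                             (≡.trans (∪-comm W V) V∪W≡C) (≡.trans (∩-comm W V) V∩W≡⊥) x∈W)

  record RelAdmissible (A B : QuasiOrder n) : Set where
    field
      refines             : A ⊑ B
      agreeOnComponents   : ∀ {x y} → SameComponent A x y → _≤_ B x y → _≤_ A x y
      classesInComponents : ∀ {x y} → x ∼⟨ B / A ⟩ y → SameComponent A x y

    agreeOnClasses : ∀ {x y} → _≤_ B x y → x ∼⟨ B / A ⟩ y → _≤_ A x y
    agreeOnClasses b c = agreeOnComponents (classesInComponents c) b
  open RelAdmissible public

  admissible⇒relAdmissible : ∀ (A B : Topology n) → Admissible (qo A) (qo B) → RelAdmissible (qo A) (qo B)
  admissible⇒relAdmissible A B (A≺B , sameRestr , classes) = record
    { refines             = λ {x} x≤y → ∈-subset⁻ (dec B x)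
                              (A≺B (↑ B x) (↑-open B x) x _ (∈-subset⁺ (dec B x) (refl (qo B) x)) x≤y)
    ; agreeOnComponents   = agree
    ; classesInComponents = λ {x} {y} c → proj₁ (Equivalence.to (classes x y) c)
    }
    where
    -- ↑x ∩ (component of x) is relatively A-open, hence relatively B-open.
    agree : ∀ {x y} → SameComponent (qo A) x y → _≤_ (qo B) x y → _≤_ (qo A) x y
    agree {x} {y} x~y x≤y = fromB (Equivalence.to (sameRestr (component A x) (component-connected A x) V)
                                                   (↑ A x , ↑-open A x , ≡.refl))
      where
      V = ↑ A x ∩ component A x
      fromB : RestrOpen (qo B) (component A x) V → _≤_ (qo A) x y
      fromB (Z , Z-open , V≡) = ∈-subset⁻ (dec A x) (proj₁ (∈-restr⁻ {Z = ↑ A x} ≡.refl y∈V))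
        where
        x∈Z = proj₁ (∈-restr⁻ V≡ (x∈p∩q⁺ (∈-subset⁺ (dec A x) (refl (qo A) x) , x∈component A x)))
        y∈V = ∈-restr⁺ V≡ (Z-open x y x∈Z x≤y) (∈-subset⁺ (SameComponent? A x) x~y)

  relAdmissible⇒admissible : ∀ (A B : Topology n) → RelAdmissible (qo A) (qo B) → Admissible (qo A) (qo B)
  relAdmissible⇒admissible A B A-adm = A≺B , sameRestr , classes
    where
    A≺B : qo A ≺ qo B
    A≺B U U-open x y x∈U x≤y = U-open x y x∈U (refines A-adm x≤y)

    sameRestr : ∀ Y → Connected (qo A) Y → SameRestr (qo A) (qo B) Y
    sameRestr Y Y-conn V = mk⇔ saturate (λ (Z , Z-open , V≡) → Z , A≺B Z Z-open , V≡)
      where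
      saturate : RestrOpen (qo A) Y V → RestrOpen (qo B) Y V
      saturate (Z , Z-open , ≡.refl) = upClosure B (Z ∩ Y) , upClosure-open B (Z ∩ Y) , ⊆-antisym ⊆-up up-⊆
        where
        ⊆-up : Z ∩ Y ⊆ upClosure B (Z ∩ Y) ∩ Y
        ⊆-up w∈ = x∈p∩q⁺ (∈-subset⁺ (Above? B (Z ∩ Y)) (_ , w∈ , refl (qo B) _) , proj₂ (x∈p∩q⁻ Z Y w∈))

        up-⊆ : upClosure B (Z ∩ Y) ∩ Y ⊆ Z ∩ Y
        up-⊆ {w} w∈ =
          let w∈up , w∈Y  = x∈p∩q⁻ (upClosure B (Z ∩ Y)) Y w∈
              z , z∈ , z≤w = ∈-subset⁻ (Above? B (Z ∩ Y)) w∈up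
              z∈Z , z∈Y   = x∈p∩q⁻ Z Y z∈
              z~w          = connected⇒SameComponent A Y-conn z∈Y w∈Y
          in  x∈p∩q⁺ (Z-open z w z∈Z (agreeOnComponents A-adm z~w z≤w) , w∈Y)

    classes : ∀ x y → (x ∼⟨ qo B / qo A ⟩ y) ⇔ (x ∼⟨ qo A / qo A ⟩ y)
    classes x y = mk⇔
      (λ c → classesInComponents A-adm c , SameComponent-sym (qo A) (classesInComponents A-adm c))
      (λ (xy , yx) → /-mono (refines A-adm) id xy , /-mono (refines A-adm) id yx)

  module _ (S : QuasiOrder n) {P T : QuasiOrder n} (S⊑P : S ⊑ P) (P-adm : RelAdmissible P T) where

    private
      SameComponent-/ : SameComponent (P / S) ⇒ SameComponent P
      SameComponent-/ = /-least (trans (P / P)) P/S⊑P/P (SameComponent-sym P ∘ P/S⊑P/P)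
        where
        P/S⊑P/P : P / S ⊑ P / P
        P/S⊑P/P = /-mono id S⊑P

      SameComponent⊑T/P : SameComponent P ⇒ _≤_ (T / P)
      SameComponent⊑T/P = /-mono (refines P-adm) id

      T/S/P/S⊑T/P : (T / S) / (P / S) ⊑ T / P
      T/S/P/S⊑T/P = /-least (trans (T / P)) (/-mono id S⊑P)
        (SameComponent⊑T/P ∘ SameComponent-sym P ∘ /-mono id S⊑P)

    /-relAdmissible : RelAdmissible (P / S) (T / S)
    /-relAdmissible = record
      { refines             = /-mono (refines P-adm) id
      ; agreeOnComponents   = λ c t → ⁺-refine-cycle (T / P) T∪S⊑T/P refine t
                                  (SameComponent⊑T/P (SameComponent-sym P (SameComponent-/ c)))
      ; classesInComponents = λ (xy , yx) → /-mono (λ p → [ inj₁ p ]) (λ p → [ inj₁ p ])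
                                  (classesInComponents P-adm (T/S/P/S⊑T/P xy , T/S/P/S⊑T/P yx))
      }
      where
      T∪S⊑T/P : QRel T S ⇒ _≤_ (T / P)
      T∪S⊑T/P = [ (λ t → [ inj₁ t ]) , (λ s → [ inj₂ (S⊑P s) ]) ]′

      refine : ∀ {a b} → QRel T S a b → a ∼⟨ T / P ⟩ b → QRel P S a b
      refine (inj₁ t) c = inj₁ (agreeOnClasses P-adm t c)
      refine (inj₂ s) _ = inj₂ s

  /-reflects-⊑ : ∀ (S P₁ : QuasiOrder n) {P₂ T} → S ⊑ P₂ → P₁ ⊑ T → RelAdmissible P₂ T →
    P₁ / S ⊑ P₂ / S → P₁ ⊑ P₂
  /-reflects-⊑ S P₁ S⊑P₂ P₁⊑T P₂-adm P₁/S⊑P₂/S p =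
    agreeOnComponents P₂-adm (/-mono id S⊑P₂ (P₁/S⊑P₂/S [ inj₁ p ])) (P₁⊑T p)

  module _ {S T U : QuasiOrder n} (S-adm : RelAdmissible S T) (U-adm : RelAdmissible U (T / S)) where

    private
      S⇒∼U : ∀ {x y} → _≤_ S x y → x ∼⟨ U ⟩ y
      S⇒∼U s = agreeOnClasses U-adm xy ([ inj₁ xy ] , [ inj₁ yx ])
             , agreeOnClasses U-adm yx ([ inj₁ yx ] , [ inj₁ xy ])
        where
        xy = [ inj₁ (refines S-adm s) ]
        yx = [ inj₂ s ]

      T⇒T⊓U : ∀ {x y} → _≤_ T x y → x ∼⟨ (T / S) / U ⟩ y → _≤_ (T ⊓ U) x y
      T⇒T⊓U t c = t , agreeOnClasses U-adm [ inj₁ t ] c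

    relAdmissible-⊓ : RelAdmissible S (T ⊓ U)
    relAdmissible-⊓ = record
      { refines             = λ s → refines S-adm s , proj₁ (S⇒∼U s)
      ; agreeOnComponents   = λ c (t , _) → agreeOnComponents S-adm c t
      ; classesInComponents = λ (xy , yx) → classesInComponents S-adm (/-mono proj₁ id xy , /-mono proj₁ id yx)
      }

    ⊓-relAdmissible : RelAdmissible (T ⊓ U) T
    ⊓-relAdmissible = record
      { refines             = proj₁
      ; agreeOnComponents   = λ c t → t , agreeOnComponents U-adm (/-mono proj₂ proj₂ c) [ inj₁ t ]
      ; classesInComponents = λ (xy , yx) → ⁺-refine-cycle (T / (T ⊓ U)) [_] refine xy yx
      }
      where
      T/T⊓U⊑T/S/U : T / (T ⊓ U) ⊑ (T / S) / U
      T/T⊓U⊑T/S/U = /-mono (λ t → [ inj₁ t ]) proj₂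

      refine : ∀ {a b} → QRel T (T ⊓ U) a b → a ∼⟨ T / (T ⊓ U) ⟩ b → QRel (T ⊓ U) (T ⊓ U) a b
      refine (inj₁ t) (ab , ba) = inj₁ (T⇒T⊓U t (T/T⊓U⊑T/S/U ab , T/T⊓U⊑T/S/U ba))
      refine (inj₂ p) _         = inj₂ p

    ⊓-/-≈ : ((T ⊓ U) / S) ≈ U
    ⊓-/-≈ x y = mk⇔ (/-least (trans U) proj₂ (proj₂ ∘ S⇒∼U)) from
      where
      refine : ∀ {a b} → QRel T S a b → a ∼⟨ (T / S) / U ⟩ b → QRel (T ⊓ U) S a b
      refine (inj₁ t) c = inj₁ (T⇒T⊓U t c)
      refine (inj₂ s) _ = inj₂ s

      from : _≤_ U x y → _≤_ ((T ⊓ U) / S) x y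
      from u = ⁺-refine-cycle ((T / S) / U) (λ q → [ inj₁ [ q ] ]) refine (refines U-adm u) [ inj₂ u ]

  infixl 7 _/ᵗ_ _⊓ᵗ_
  _/ᵗ_ : Topology n → Topology n → Topology n
  T /ᵗ S = record { qo = qo T / qo S ; dec = /-dec (dec T) (dec S) }

  _⊓ᵗ_ : Topology n → Topology n → Topology n
  T ⊓ᵗ U = record { qo = qo T ⊓ qo U ; dec = λ x y → dec T x y ×-dec dec U x y }

proposition2p7 : ∀ {n : ℕ} (T T'' : Topology n) → Admissible (qo T'') (qo T) →
    ((T' : Topology n) → Admissible (qo T'') (qo T') → Admissible (qo T') (qo T) →
      Admissible (qo T' / qo T'') (qo T / qo T''))
    × ((T₁ T₂ : Topology n) →
      Admissible (qo T'') (qo T₁) → Admissible (qo T₁) (qo T) →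
      Admissible (qo T'') (qo T₂) → Admissible (qo T₂) (qo T) →
      (qo T₁ / qo T'') ≈ (qo T₂ / qo T'') → qo T₁ ≈ qo T₂)
    × ((U : Topology n) → Admissible (qo U) (qo T / qo T'') →
      Σ (Topology n) (λ T' → Admissible (qo T'') (qo T') × Admissible (qo T') (qo T)
        × ((qo T' / qo T'') ≈ qo U)))
proposition2p7 {n} T S S-T = into , injective , onto
  where
  rel = admissible⇒relAdmissible

  into : ∀ P → Admissible (qo S) (qo P) → Admissible (qo P) (qo T) → Admissible (qo P / qo S) (qo T / qo S)
  into P S-P P-T = relAdmissible⇒admissible (P /ᵗ S) (T /ᵗ S)
    (/-relAdmissible (qo S) (refines (rel S P S-P)) (rel P T P-T))

  injective : ∀ P₁ P₂ → Admissible (qo S) (qo P₁) → Admissible (qo P₁) (qo T) →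
    Admissible (qo S) (qo P₂) → Admissible (qo P₂) (qo T) → (qo P₁ / qo S) ≈ (qo P₂ / qo S) → qo P₁ ≈ qo P₂
  injective P₁ P₂ S-P₁ P₁-T S-P₂ P₂-T P₁/S≈P₂/S x y = mk⇔
    (/-reflects-⊑ (qo S) (qo P₁) (refines (rel S P₂ S-P₂)) (refines (rel P₁ T P₁-T)) (rel P₂ T P₂-T)
      (Equivalence.to (P₁/S≈P₂/S _ _)))
    (/-reflects-⊑ (qo S) (qo P₂) (refines (rel S P₁ S-P₁)) (refines (rel P₂ T P₂-T)) (rel P₁ T P₁-T)
      (Equivalence.from (P₁/S≈P₂/S _ _)))

  onto : ∀ U → Admissible (qo U) (qo T / qo S) →
    Σ (Topology n) (λ P → Admissible (qo S) (qo P) × Admissible (qo P) (qo T) × ((qo P / qo S) ≈ qo U))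
  onto U U-T/S = T ⊓ᵗ U
    , relAdmissible⇒admissible S (T ⊓ᵗ U) (relAdmissible-⊓ S-rel U-rel)
    , relAdmissible⇒admissible (T ⊓ᵗ U) T (⊓-relAdmissible S-rel U-rel)
    , ⊓-/-≈ S-rel U-rel
    where
    S-rel = rel S T S-T
    U-rel = rel U (T /ᵗ S) U-T/S
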